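{- Let $N$ be a pomonoid. Then $N$ is integral if and only if there exist a partially ordered group $G$, a subpomonoid $M$ of the negative cone $G^-=\{g\in G: g\leq 1\}$ of $G$, and a nucleus $\gamma$ on $M$ such that $N$ is isomorphic to the nuclear image $M_\gamma$. Moreover, $N$ is commutative and integral if and only if the same holds with $G$ a partially ordered Abelian group.
   Context: A pomonoid is a structure $\langle M,\leq,\cdot,1\rangle$ where $\langle M,\cdot,1\rangle$ is a monoid and $\leq$ is a partial order such that multiplication is isotone in both arguments; it is integral if $1$ is its greatest element. A partially ordered group is a group with a partial order making it a pomonoid; its negative cone $\{g: g\leq 1\}$ is a subpomonoid. A subpomonoid is a submonoid with the restricted order. A nucleus on a pomonoid $M$ is a monotone map $\gamma\colon M\to M$ with $a\leq\gamma(a)=\gamma(\gamma(a))$ and $\gamma(a)\gamma(b)\leq\gamma(ab)$. The nuclear image $M_\gamma$ is $\{a:\gamma(a)=a\}$ with the inherited order, multiplication $a\cdot_\gamma b:=\gamma(ab)$ and unit $\gamma(1)$. -}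

module Defs where

open import Level using (Level; _⊔_; suc)
open import Data.Product using (Σ; Σ-syntax; _×_; _,_; proj₁; proj₂)
open import Relation.Binary.Core using (Rel)
open import Relation.Binary.Structures using (IsPartialOrder)
open import Algebra.Structures using (IsMonoid; IsGroup)

record RawPomonoid c ℓ₁ ℓ₂ : Set (suc (c ⊔ ℓ₁ ⊔ ℓ₂)) where
  infixl 7 _∙_
  infix 4 _≈_ _≤_
  field
    Carrier : Set c
    _≈_     : Rel Carrier ℓ₁
    _≤_     : Rel Carrier ℓ₂
    _∙_     : Carrier → Carrier → Carrier
    ε       : Carrier

record Pomonoid c ℓ₁ ℓ₂ : Set (suc (c ⊔ ℓ₁ ⊔ ℓ₂)) where
  infixl 7 _∙_
  infix 4 _≈_ _≤_
  field
    Carrier        : Set c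
    _≈_            : Rel Carrier ℓ₁
    _≤_            : Rel Carrier ℓ₂
    _∙_            : Carrier → Carrier → Carrier
    ε              : Carrier
    isMonoid       : IsMonoid _≈_ _∙_ ε
    isPartialOrder : IsPartialOrder _≈_ _≤_
    monoˡ          : ∀ {a b} z → a ≤ b → a ∙ z ≤ b ∙ z
    monoʳ          : ∀ {a b} z → a ≤ b → z ∙ a ≤ z ∙ b

  raw : RawPomonoid c ℓ₁ ℓ₂
  raw = record { Carrier = Carrier ; _≈_ = _≈_ ; _≤_ = _≤_ ; _∙_ = _∙_ ; ε = ε }

IsIntegral : ∀ {c ℓ₁ ℓ₂} → Pomonoid c ℓ₁ ℓ₂ → Set (c ⊔ ℓ₂)
IsIntegral N = ∀ a → a ≤ ε
  where open Pomonoid N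

IsCommutative : ∀ {c ℓ₁ ℓ₂} → Pomonoid c ℓ₁ ℓ₂ → Set (c ⊔ ℓ₁)
IsCommutative N = ∀ a b → (a ∙ b) ≈ (b ∙ a)
  where open Pomonoid N

record POGroup c ℓ₁ ℓ₂ : Set (suc (c ⊔ ℓ₁ ⊔ ℓ₂)) where
  infixl 7 _∙_
  infix 8 _⁻¹
  infix 4 _≈_ _≤_
  field
    Carrier        : Set c
    _≈_            : Rel Carrier ℓ₁
    _≤_            : Rel Carrier ℓ₂
    _∙_            : Carrier → Carrier → Carrier
    ε              : Carrier
    _⁻¹            : Carrier → Carrier
    isGroup        : IsGroup _≈_ _∙_ ε _⁻¹
    isPartialOrder : IsPartialOrder _≈_ _≤_
    monoˡ          : ∀ {a b} z → a ≤ b → a ∙ z ≤ b ∙ z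
    monoʳ          : ∀ {a b} z → a ≤ b → z ∙ a ≤ z ∙ b

  pomonoid : Pomonoid c ℓ₁ ℓ₂
  pomonoid = record
    { Carrier = Carrier ; _≈_ = _≈_ ; _≤_ = _≤_ ; _∙_ = _∙_ ; ε = ε
    ; isMonoid = IsGroup.isMonoid isGroup
    ; isPartialOrder = isPartialOrder ; monoˡ = monoˡ ; monoʳ = monoʳ }

IsAbelian : ∀ {c ℓ₁ ℓ₂} → POGroup c ℓ₁ ℓ₂ → Set (c ⊔ ℓ₁)
IsAbelian G = ∀ a b → (a ∙ b) ≈ (b ∙ a)
  where open POGroup G

record NegSubpomonoid {c ℓ₁ ℓ₂} (G : POGroup c ℓ₁ ℓ₂) (s : Level)
       : Set (c ⊔ ℓ₁ ⊔ ℓ₂ ⊔ suc s) where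
  open POGroup G
  field
    ∈M      : Carrier → Set s
    resp    : ∀ {x y} → x ≈ y → ∈M x → ∈M y
    ε∈      : ∈M ε
    ∙∈      : ∀ {x y} → ∈M x → ∈M y → ∈M (x ∙ y)
    ⊆G⁻     : ∀ {x} → ∈M x → x ≤ ε

subRaw : ∀ {c ℓ₁ ℓ₂ s} (G : POGroup c ℓ₁ ℓ₂) → NegSubpomonoid G s
       → RawPomonoid (c ⊔ s) ℓ₁ ℓ₂
subRaw G M = record
  { Carrier = Σ Carrier ∈M
  ; _≈_ = λ x y → proj₁ x ≈ proj₁ y
  ; _≤_ = λ x y → proj₁ x ≤ proj₁ y
  ; _∙_ = λ x y → (proj₁ x ∙ proj₁ y) , ∙∈ (proj₂ x) (proj₂ y)
  ; ε = ε , ε∈ }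
  where open POGroup G
        open NegSubpomonoid M

-- Nucleus on an ordered monoid M (γ respects ≈, as M is a setoid).

record Nucleus {c ℓ₁ ℓ₂} (M : RawPomonoid c ℓ₁ ℓ₂) : Set (c ⊔ ℓ₁ ⊔ ℓ₂) where
  open RawPomonoid M
  field
    γ       : Carrier → Carrier
    cong    : ∀ {a b} → a ≈ b → γ a ≈ γ b
    mono    : ∀ {a b} → a ≤ b → γ a ≤ γ b
    extens  : ∀ a → a ≤ γ a
    idem    : ∀ a → γ (γ a) ≈ γ a
    mult    : ∀ a b → (γ a ∙ γ b) ≤ γ (a ∙ b)

nuclearImage : ∀ {c ℓ₁ ℓ₂} (M : RawPomonoid c ℓ₁ ℓ₂) → Nucleus M
             → RawPomonoid (c ⊔ ℓ₁) ℓ₁ ℓ₂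
nuclearImage M n = record
  { Carrier = Σ[ a ∈ Carrier ] (γ a ≈ a)
  ; _≈_ = λ x y → proj₁ x ≈ proj₁ y
  ; _≤_ = λ x y → proj₁ x ≤ proj₁ y
  ; _∙_ = λ x y → γ (proj₁ x ∙ proj₁ y) , idem (proj₁ x ∙ proj₁ y)
  ; ε = γ ε , idem ε }
  where open RawPomonoid M
        open Nucleus n

record Iso {a ℓa₁ ℓa₂ b ℓb₁ ℓb₂}
           (A : RawPomonoid a ℓa₁ ℓa₂) (B : RawPomonoid b ℓb₁ ℓb₂)
           : Set (a ⊔ ℓa₁ ⊔ ℓa₂ ⊔ b ⊔ ℓb₁ ⊔ ℓb₂) where
  module A = RawPomonoid A
  module B = RawPomonoid B
  field
    to        : A.Carrier → B.Carrier
    from      : B.Carrier → A.Carrier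
    to-cong   : ∀ {x y} → x A.≈ y → to x B.≈ to y
    from-cong : ∀ {x y} → x B.≈ y → from x A.≈ from y
    to-from   : ∀ y → to (from y) B.≈ y
    from-to   : ∀ x → from (to x) A.≈ x
    to-mono   : ∀ {x y} → x A.≤ y → to x B.≤ to y
    to-refl   : ∀ {x y} → to x B.≤ to y → x A.≤ y
    to-∙      : ∀ x y → to (x A.∙ y) B.≈ (to x B.∙ to y)
    to-ε      : to A.ε B.≈ B.ε

Representable : ∀ {c ℓ₁ ℓ₂} (ℓ : Level)
              → (POGroup ℓ ℓ ℓ → Set ℓ)
              → Pomonoid c ℓ₁ ℓ₂ → Set (c ⊔ ℓ₁ ⊔ ℓ₂ ⊔ suc ℓ)
Representable ℓ P N =
  Σ[ G ∈ POGroup ℓ ℓ ℓ ] (P G ×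
  (Σ[ M ∈ NegSubpomonoid G ℓ ]
  (Σ[ γ ∈ Nucleus (subRaw G M) ]
   Iso (Pomonoid.raw N) (nuclearImage (subRaw G M) γ))))

-- Integrality is forced: in a representation every element of M lies below 1 in G while the unit
-- γ(1) of M_γ lies above 1; an Abelian G likewise makes M_γ commutative.
-- Conversely, for integral N take words in letters a and a⁻¹ (a ∈ N), preordered by v ⊑ w iff every
-- context K _ L turns an observation K v L ⇓ t into K w L ⇓ t. This is compatible with concatenation,
-- so it yields a partially ordered group once a a⁻¹ and a⁻¹ a are equivalent to the empty word. Let M
-- consist of the positive words and let γ send a₁ ⋯ aₙ to the one-letter word of its product in N;
-- then N ≅ M_γ provided letters lie below 1, are monotone and submultiplicative, and the order on
-- positive words reflects their products. The observation is that w rewrites to a positive word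
-- with product above t, where a letter may be refined into a list with smaller product, a negative
-- letter erased, and q⁻¹ cancelled against an adjacent p ≥ q. That a a⁻¹ may be deleted is shown by
-- simulating rewrites, and a⁻¹ a follows by reversing words over the opposite monoid. For
-- commutative N the observation forgets the order of letters, which makes the group Abelian.

module Submission where

open import Defs
open import Level using (Level; _⊔_; Lift; lift)
open import Data.Unit using (⊤; tt)
open import Data.Empty using (⊥; ⊥-elim)
open import Data.Product using (_×_; _,_; proj₁; proj₂; Σ-syntax)
open import Data.Sum using (_⊎_; inj₁; inj₂)
open import Data.Maybe using (Maybe; just; nothing)
open import Data.List using (List; []; _∷_; [_]; _++_; map; foldr; reverse; mapMaybe)
open import Data.List.Properties
  using (++-assoc; ++-identityʳ; map-++; map-injective; ∷-injectiveʳ;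
         reverse-++; reverse-map; unfold-reverse; reverse-involutive)
open import Data.List.Relation.Binary.Permutation.Propositional as ↭ using (_↭_; ↭⇒↭ₛ′)
open import Data.List.Relation.Binary.Permutation.Propositional.Properties
  using (++⁺ˡ; ++⁺ʳ; ++-comm; shifts; mapMaybe-↭)
import Data.List.Relation.Binary.Permutation.Setoid.Properties as PermutationProperties
open import Data.List.Relation.Ternary.Interleaving.Propositional
  using (Interleaving; []; consˡ; consʳ; toPermutation)
open import Function.Base using (flip; _∘_)
open import Function.Bundles using (_⇔_; mk⇔)
open import Relation.Binary.PropositionalEquality
  using (_≡_; refl; sym; trans; cong; cong₂; subst; subst₂)
open import Relation.Binary.Bundles using (Setoid; Poset)
open import Relation.Binary.Structures using (IsEquivalence; IsPartialOrder)
open import Relation.Binary.Construct.Closure.ReflexiveTransitive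
  using (Star; _◅_; _◅◅_; gmap; return) renaming (ε to done)
import Relation.Binary.Reasoning.PartialOrder as PosetReasoning
import Relation.Binary.Reasoning.Setoid as SetoidReasoning
open import Algebra.Bundles using (CommutativeSemigroup)
open import Algebra.Structures using (IsMonoid)
open import Algebra.Consequences.Setoid using (assoc∧id∧invʳ⇒invˡ-unique)
import Algebra.Construct.Flip.Op as Op
import Algebra.Properties.CommutativeSemigroup as CommutativeSemigroupProperties

module PomonoidProperties {c ℓ₁ ℓ₂} (N : Pomonoid c ℓ₁ ℓ₂) where
  open Pomonoid N public
  open IsMonoid isMonoid public
    using (setoid; assoc; identityˡ; identityʳ; ∙-cong; ∙-congˡ; ∙-congʳ)
    renaming (refl to ≈-refl; sym to ≈-sym; trans to ≈-trans; reflexive to ≡⇒≈)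
  open IsPartialOrder isPartialOrder public
    using (antisym; ≤-respˡ-≈; ≤-respʳ-≈)
    renaming (reflexive to ≤-reflexive; trans to ≤-trans; refl to ≤-refl)

  poset : Poset c ℓ₁ ℓ₂
  poset = record { isPartialOrder = isPartialOrder }

  ∙-mono : ∀ {a b x y} → a ≤ b → x ≤ y → a ∙ x ≤ b ∙ y
  ∙-mono {b = b} {x} a≤b x≤y = ≤-trans (monoˡ x a≤b) (monoʳ b x≤y)

  π : List Carrier → Carrier
  π = foldr _∙_ ε

  π-++ : ∀ u v → π (u ++ v) ≈ π u ∙ π v
  π-++ []      v = ≈-sym (identityˡ (π v))
  π-++ (a ∷ u) v = ≈-trans (∙-congˡ (π-++ u v)) (≈-sym (assoc a (π u) (π v)))

  π-[_] : ∀ a → π [ a ] ≈ a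
  π-[_] = identityʳ

-- Representations inside a partially ordered group

module Representation {c ℓ₁ ℓ₂} (N : Pomonoid c ℓ₁ ℓ₂)
  (G : POGroup (c ⊔ ℓ₁ ⊔ ℓ₂) (c ⊔ ℓ₁ ⊔ ℓ₂) (c ⊔ ℓ₁ ⊔ ℓ₂))
  (ι : Pomonoid.Carrier N → POGroup.Carrier G) where

  private
    module N = PomonoidProperties N
    module G = PomonoidProperties (POGroup.pomonoid G)

  word : List N.Carrier → G.Carrier
  word u = G.π (map ι u)

  word-++ : ∀ u v → word (u ++ v) G.≈ word u G.∙ word v
  word-++ u v = G.≈-trans (G.≡⇒≈ (cong G.π (map-++ ι u v))) (G.π-++ (map ι u) (map ι v))

  module _ (ι-negative : ∀ a → ι a G.≤ G.ε)
           (ι-mono     : ∀ {a b} → a N.≤ b → ι a G.≤ ι b)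
           (ι-∙        : ∀ a b → ι a G.∙ ι b G.≤ ι (a N.∙ b))
           (ι-ε        : G.ε G.≤ ι N.ε)
           (word-reflects : ∀ u v → word u G.≤ word v → N.π u N.≤ N.π v)
           where

    ι-cong : ∀ {a b} → a N.≈ b → ι a G.≈ ι b
    ι-cong a≈b = G.antisym (ι-mono (N.≤-reflexive a≈b)) (ι-mono (N.≤-reflexive (N.≈-sym a≈b)))

    word-cong-reflects : ∀ u v → word u G.≈ word v → N.π u N.≈ N.π v
    word-cong-reflects u v eq =
      N.antisym (word-reflects u v (G.≤-reflexive eq)) (word-reflects v u (G.≤-reflexive (G.≈-sym eq)))

    word-negative : ∀ u → word u G.≤ G.ε
    word-negative []      = G.≤-refl
    word-negative (a ∷ u) = G.≤-respʳ-≈ (G.identityʳ G.ε) (G.∙-mono (ι-negative a) (word-negative u))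

    word≤ι∘π : ∀ u → word u G.≤ ι (N.π u)
    word≤ι∘π []      = ι-ε
    word≤ι∘π (a ∷ u) = G.≤-trans (G.monoʳ (ι a) (word≤ι∘π u)) (ι-∙ a (N.π u))

    word-[_] : ∀ a → word [ a ] G.≈ ι a
    word-[ a ] = G.π-[ ι a ]

    images : NegSubpomonoid G (c ⊔ ℓ₁ ⊔ ℓ₂)
    images = record
      { ∈M   = λ g → Σ[ u ∈ List N.Carrier ] (g G.≈ word u)
      ; resp = λ { g≈h (u , g≈u) → u , G.≈-trans (G.≈-sym g≈h) g≈u }
      ; ε∈   = [] , G.≈-refl
      ; ∙∈   = λ { (u , g≈u) (v , h≈v) →
                   u ++ v , G.≈-trans (G.∙-cong g≈u h≈v) (G.≈-sym (word-++ u v)) }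
      ; ⊆G⁻  = λ { (u , g≈u) → G.≤-respˡ-≈ (G.≈-sym g≈u) (word-negative u) }
      }

    private
      S : RawPomonoid (c ⊔ ℓ₁ ⊔ ℓ₂) (c ⊔ ℓ₁ ⊔ ℓ₂) (c ⊔ ℓ₁ ⊔ ℓ₂)
      S = subRaw G images
      module S = RawPomonoid S

    closure : S.Carrier → S.Carrier
    closure (_ , u , _) = ι (N.π u) , [ N.π u ] , G.≈-sym word-[ N.π u ]

    π-cong-images : ∀ {g h} u v → g G.≈ word u → h G.≈ word v → g G.≈ h → N.π u N.≈ N.π v
    π-cong-images u v g≈u h≈v g≈h =
      word-cong-reflects u v (G.≈-trans (G.≈-sym g≈u) (G.≈-trans g≈h h≈v))

    π-mono-images : ∀ {g h} u v → g G.≈ word u → h G.≈ word v → g G.≤ h → N.π u N.≤ N.π v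
    π-mono-images u v g≈u h≈v g≤h =
      word-reflects u v (G.≤-respʳ-≈ h≈v (G.≤-respˡ-≈ g≈u g≤h))

    nucleus : Nucleus S
    nucleus = record
      { γ      = closure
      ; cong   = λ { {_ , u , g≈u} {_ , v , h≈v} g≈h → ι-cong (π-cong-images u v g≈u h≈v g≈h) }
      ; mono   = λ { {_ , u , g≈u} {_ , v , h≈v} g≤h → ι-mono (π-mono-images u v g≈u h≈v g≤h) }
      ; extens = λ { (_ , u , g≈u) → G.≤-respˡ-≈ (G.≈-sym g≈u) (word≤ι∘π u) }
      ; idem   = λ { (_ , u , _) → ι-cong N.π-[ N.π u ] }
      ; mult   = λ { (_ , u , _) (_ , v , _) →
                   G.≤-respʳ-≈ (ι-cong (N.≈-sym (N.π-++ u v))) (ι-∙ (N.π u) (N.π v)) }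
      }

    embedding : Iso (Pomonoid.raw N) (nuclearImage S nucleus)
    embedding = record
      { to        = λ a → (ι a , [ a ] , G.≈-sym word-[ a ]) , ι-cong N.π-[ a ]
      ; from      = λ { ((_ , u , _) , _) → N.π u }
      ; to-cong   = ι-cong
      ; from-cong = λ { {(_ , u , g≈u) , _} {(_ , v , h≈v) , _} g≈h → π-cong-images u v g≈u h≈v g≈h }
      ; to-from   = λ { (_ , fixed) → fixed }
      ; from-to   = N.π-[_]
      ; to-mono   = ι-mono
      ; to-refl   = λ {a} {b} ιa≤ιb → N.≤-respʳ-≈ N.π-[ b ] (N.≤-respˡ-≈ N.π-[ a ]
                      (π-mono-images [ a ] [ b ] (G.≈-sym word-[ a ]) (G.≈-sym word-[ b ]) ιa≤ιb))
      ; to-∙      = λ a b → ι-cong (N.∙-congˡ (N.≈-sym N.π-[ b ]))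
      ; to-ε      = G.≈-refl
      }

    representation : Σ[ M ∈ NegSubpomonoid G (c ⊔ ℓ₁ ⊔ ℓ₂) ] Σ[ γ ∈ Nucleus (subRaw G M) ]
                       Iso (Pomonoid.raw N) (nuclearImage (subRaw G M) γ)
    representation = images , nucleus , embedding

module _ {c ℓ₁ ℓ₂} (N : Pomonoid c ℓ₁ ℓ₂) {ℓ : Level} where
  open PomonoidProperties N

  representable⇒integral : ∀ {P : POGroup ℓ ℓ ℓ → Set ℓ} → Representable ℓ P N → IsIntegral N
  representable⇒integral (G , _ , M , nucleus , iso) a =
    to-refl (G.≤-trans (⊆G⁻ (proj₂ (proj₁ (to a))))
                       (G.≤-respʳ-≈ (G.≈-sym to-ε) (extens (G.ε , ε∈))))
    where
      module G = PomonoidProperties (POGroup.pomonoid G)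
      open NegSubpomonoid M
      open Nucleus nucleus
      open Iso iso

  abelian-representable⇒commutative : Representable ℓ IsAbelian N → IsCommutative N
  abelian-representable⇒commutative (G , abelian , _ , nucleus , iso) a b = begin
    a ∙ b              ≈⟨ from-to (a ∙ b) ⟨
    from (to (a ∙ b))  ≈⟨ from-cong to-ab≈to-ba ⟩
    from (to (b ∙ a))  ≈⟨ from-to (b ∙ a) ⟩
    b ∙ a              ∎
    where
      module G = PomonoidProperties (POGroup.pomonoid G)
      open Iso iso
      open SetoidReasoning setoid
      to-ab≈to-ba : to (a ∙ b) B.≈ to (b ∙ a)
      to-ab≈to-ba =
        G.≈-trans (to-∙ a b) (G.≈-trans (Nucleus.cong nucleus (abelian _ _)) (G.≈-sym (to-∙ b a)))

-- The context order on signed words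

-- ℓ only raises the universe, so that words can carry a po-group at level c ⊔ ℓ₁ ⊔ ℓ₂.
module Signed {a} (ℓ : Level) (A : Set a) where

  data Letter : Set (a ⊔ ℓ) where
    pos neg : A → Letter

  Word : Set (a ⊔ ℓ)
  Word = List Letter

  invert : Letter → Letter
  invert (pos x) = neg x
  invert (neg x) = pos x

  invert-involutive : ∀ s → invert (invert s) ≡ s
  invert-involutive (pos x) = refl
  invert-involutive (neg x) = refl

  inverse : Word → Word
  inverse []      = []
  inverse (s ∷ w) = inverse w ++ [ invert s ]

module ContextOrder {c ℓ₁ ℓ₂} (N : Pomonoid c ℓ₁ ℓ₂)
  (_⇓_ : Signed.Word (c ⊔ ℓ₁ ⊔ ℓ₂) (Pomonoid.Carrier N) → Pomonoid.Carrier N →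
         Set (c ⊔ ℓ₁ ⊔ ℓ₂))
  where

  open PomonoidProperties N
  open Signed (c ⊔ ℓ₁ ⊔ ℓ₂) Carrier

  private
    ℓ : Level
    ℓ = c ⊔ ℓ₁ ⊔ ℓ₂

  infix 4 _⊑_ _≋_

  _⊑_ : Word → Word → Set ℓ
  v ⊑ w = ∀ K L t → (K ++ v ++ L) ⇓ t → (K ++ w ++ L) ⇓ t

  _≋_ : Word → Word → Set ℓ
  v ≋ w = v ⊑ w × w ⊑ v

  ⊑-refl : ∀ {w} → w ⊑ w
  ⊑-refl K L t w⇓t = w⇓t

  ⊑-trans : ∀ {u v w} → u ⊑ v → v ⊑ w → u ⊑ w
  ⊑-trans u⊑v v⊑w K L t = v⊑w K L t ∘ u⊑v K L t

  ++-monoˡ-⊑ : ∀ {v w} z → v ⊑ w → v ++ z ⊑ w ++ z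
  ++-monoˡ-⊑ {v} {w} z v⊑w K L t vz⇓t =
    subst (λ x → (K ++ x) ⇓ t) (sym (++-assoc w z L))
      (v⊑w K (z ++ L) t (subst (λ x → (K ++ x) ⇓ t) (++-assoc v z L) vz⇓t))

  ++-monoʳ-⊑ : ∀ {v w} z → v ⊑ w → z ++ v ⊑ z ++ w
  ++-monoʳ-⊑ {v} {w} z v⊑w K L t zv⇓t =
    subst (_⇓ t) (reassoc w) (v⊑w (K ++ z) L t (subst (_⇓ t) (sym (reassoc v)) zv⇓t))
    where
      reassoc : ∀ x → (K ++ z) ++ x ++ L ≡ K ++ (z ++ x) ++ L
      reassoc x = trans (++-assoc K z (x ++ L)) (cong (K ++_) (sym (++-assoc z x L)))

  ≋-refl : ∀ {w} → w ≋ w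
  ≋-refl = ⊑-refl , ⊑-refl

  ≋-sym : ∀ {v w} → v ≋ w → w ≋ v
  ≋-sym (v⊑w , w⊑v) = w⊑v , v⊑w

  ≋-trans : ∀ {u v w} → u ≋ v → v ≋ w → u ≋ w
  ≋-trans (u⊑v , v⊑u) (v⊑w , w⊑v) = ⊑-trans u⊑v v⊑w , ⊑-trans w⊑v v⊑u

  ≡⇒≋ : ∀ {v w} → v ≡ w → v ≋ w
  ≡⇒≋ refl = ≋-refl

  ++-cong-≋ : ∀ {v v′ w w′} → v ≋ v′ → w ≋ w′ → v ++ w ≋ v′ ++ w′
  ++-cong-≋ {v} {v′} {w} {w′} (v⊑v′ , v′⊑v) (w⊑w′ , w′⊑w) =
    ⊑-trans (++-monoˡ-⊑ w v⊑v′) (++-monoʳ-⊑ v′ w⊑w′) ,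
    ⊑-trans (++-monoˡ-⊑ w′ v′⊑v) (++-monoʳ-⊑ v w′⊑w)

  ≋-isEquivalence : IsEquivalence _≋_
  ≋-isEquivalence = record { refl = ≋-refl ; sym = ≋-sym ; trans = ≋-trans }

  ⊑-isPartialOrder : IsPartialOrder _≋_ _⊑_
  ⊑-isPartialOrder = record
    { isPreorder = record { isEquivalence = ≋-isEquivalence ; reflexive = proj₁ ; trans = ⊑-trans }
    ; antisym    = _,_
    }

  ++-isMonoid-≋ : IsMonoid _≋_ _++_ []
  ++-isMonoid-≋ = record
    { isSemigroup = record
      { isMagma = record { isEquivalence = ≋-isEquivalence ; ∙-cong = ++-cong-≋ }
      ; assoc   = λ u v w → ≡⇒≋ (++-assoc u v w) }
    ; identity = (λ w → ≋-refl) , (λ w → ≡⇒≋ (++-identityʳ w))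
    }

  module _ (letter-inverseʳ : ∀ s → s ∷ invert s ∷ [] ≋ []) where

    inverseʳ : ∀ w → w ++ inverse w ≋ []
    inverseʳ []      = ≋-refl
    inverseʳ (s ∷ w) =
      ≋-trans (≡⇒≋ (cong (s ∷_) (sym (++-assoc w (inverse w) [ invert s ]))))
              (≋-trans (++-cong-≋ {[ s ]} ≋-refl (++-cong-≋ (inverseʳ w) ≋-refl)) (letter-inverseʳ s))

    letter-inverseˡ : ∀ s → invert s ∷ s ∷ [] ≋ []
    letter-inverseˡ s =
      subst (λ s′ → invert s ∷ s′ ∷ [] ≋ []) (invert-involutive s) (letter-inverseʳ (invert s))

    inverseˡ : ∀ w → inverse w ++ w ≋ []
    inverseˡ []      = ≋-refl
    inverseˡ (s ∷ w) =
      ≋-trans (≡⇒≋ (++-assoc (inverse w) [ invert s ] (s ∷ w)))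
              (≋-trans (++-cong-≋ {inverse w} ≋-refl (++-cong-≋ (letter-inverseˡ s) ≋-refl)) (inverseˡ w))

    inverse-cong : ∀ {v w} → v ≋ w → inverse v ≋ inverse w
    inverse-cong {v} {w} v≋w =
      assoc∧id∧invʳ⇒invˡ-unique ≋-setoid ++-cong-≋
        (λ u v w → ≡⇒≋ (++-assoc u v w)) (IsMonoid.identity ++-isMonoid-≋) inverseʳ
        (inverse v) w (≋-trans (++-cong-≋ ≋-refl (≋-sym v≋w)) (inverseˡ v))
      where
        ≋-setoid : Setoid ℓ ℓ
        ≋-setoid = record { isEquivalence = ≋-isEquivalence }

    group : POGroup ℓ ℓ ℓ
    group = record
      { Carrier = Word ; _≈_ = _≋_ ; _≤_ = _⊑_ ; _∙_ = _++_ ; ε = [] ; _⁻¹ = inverse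
      ; isGroup = record
        { isMonoid = ++-isMonoid-≋ ; inverse = inverseˡ , inverseʳ ; ⁻¹-cong = inverse-cong }
      ; isPartialOrder = ⊑-isPartialOrder
      ; monoˡ = ++-monoˡ-⊑
      ; monoʳ = ++-monoʳ-⊑
      }

    module _ (⇓-sound    : ∀ u t → map pos u ⇓ t → t ≤ π u)
             (⇓-complete : ∀ u → map pos u ⇓ π u)
             (letter-negative : ∀ a → [ pos a ] ⊑ [])
             (letter-mono     : ∀ {a b} → a ≤ b → [ pos a ] ⊑ [ pos b ])
             (letter-∙        : ∀ a b → pos a ∷ pos b ∷ [] ⊑ [ pos (a ∙ b) ])
             (letter-ε        : [] ⊑ [ pos ε ])
             where

      positive-reflects : ∀ u v → map pos u ⊑ map pos v → π u ≤ π v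
      positive-reflects u v u⊑v =
        ⇓-sound v (π u) (subst (_⇓ π u) (++-identityʳ (map pos v))
          (u⊑v [] [] (π u) (subst (_⇓ π u) (sym (++-identityʳ (map pos u))) (⇓-complete u))))

      open Representation N group (λ a → [ pos a ]) using (word)

      word≡map-pos : ∀ u → word u ≡ map pos u
      word≡map-pos []      = refl
      word≡map-pos (a ∷ u) = cong (pos a ∷_) (word≡map-pos u)

      representation : Σ[ M ∈ NegSubpomonoid group ℓ ] Σ[ γ ∈ Nucleus (subRaw group M) ]
                         Iso (Pomonoid.raw N) (nuclearImage (subRaw group M) γ)
      representation =
        Representation.representation N group (λ a → [ pos a ])
          letter-negative letter-mono letter-∙ letter-ε
          (λ u v → positive-reflects u v ∘ subst₂ _⊑_ (word≡map-pos u) (word≡map-pos v))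

-- Rewriting to positive words

-- Parameterised by the raw pomonoid only, so that Rewriting (raw (opposite (opposite N))) is
-- definitionally Rewriting (raw N); ⇓-cancel⁻⁺ depends on this.
module Rewriting {c ℓ₁ ℓ₂} (N : RawPomonoid c ℓ₁ ℓ₂) where
  open RawPomonoid N
  open Signed (c ⊔ ℓ₁ ⊔ ℓ₂) Carrier

  private
    ℓ : Level
    ℓ = c ⊔ ℓ₁ ⊔ ℓ₂

    π : List Carrier → Carrier
    π = foldr _∙_ ε

  infix 4 _⟶_ _⟶*_ _⇓_

  data _⟶_ : Word → Word → Set ℓ where
    refine   : ∀ {x R w} → π R ≤ x → pos x ∷ w ⟶ map pos R ++ w
    erase    : ∀ {q w} → neg q ∷ w ⟶ w
    cancel⁺⁻ : ∀ {p q w} → q ≤ p → pos p ∷ neg q ∷ w ⟶ w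
    cancel⁻⁺ : ∀ {p q w} → q ≤ p → neg q ∷ pos p ∷ w ⟶ w
    there    : ∀ {s w w′} → w ⟶ w′ → s ∷ w ⟶ s ∷ w′

  _⟶*_ : Word → Word → Set ℓ
  _⟶*_ = Star _⟶_

  _⇓_ : Word → Carrier → Set ℓ
  w ⇓ t = Σ[ u ∈ List Carrier ] (w ⟶* map pos u × t ≤ π u)

  ≡⇒⟶* : ∀ {w v} → w ≡ v → w ⟶* v
  ≡⇒⟶* refl = done

  ⟶-congˡ : ∀ K {w w′} → w ⟶ w′ → K ++ w ⟶ K ++ w′
  ⟶-congˡ []      s = s
  ⟶-congˡ (k ∷ K) s = there (⟶-congˡ K s)

  ⟶-congʳ : ∀ L {w w′} → w ⟶ w′ → w ++ L ⟶ w′ ++ L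
  ⟶-congʳ L (refine {R = R} {w} R≤x) =
    subst (_ ⟶_) (sym (++-assoc (map pos R) w L)) (refine {R = R} R≤x)
  ⟶-congʳ L erase           = erase
  ⟶-congʳ L (cancel⁺⁻ q≤p) = cancel⁺⁻ q≤p
  ⟶-congʳ L (cancel⁻⁺ q≤p) = cancel⁻⁺ q≤p
  ⟶-congʳ L (there s)       = there (⟶-congʳ L s)

  ⟶*-congˡ : ∀ K {w w′} → w ⟶* w′ → K ++ w ⟶* K ++ w′
  ⟶*-congˡ K = gmap (K ++_) (⟶-congˡ K)

  ⇓-step : ∀ {w v t} → w ⟶ v → v ⇓ t → w ⇓ t
  ⇓-step s (u , v⟶*u , t≤u) = u , s ◅ v⟶*u , t≤u

module RewritingProperties {c ℓ₁ ℓ₂} (N : Pomonoid c ℓ₁ ℓ₂) (integral : IsIntegral N) where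
  open PomonoidProperties N
  open Rewriting raw
  open Signed (c ⊔ ℓ₁ ⊔ ℓ₂) Carrier

  private
    ℓ : Level
    ℓ = c ⊔ ℓ₁ ⊔ ℓ₂

  pos-injective : ∀ {a b} → pos a ≡ pos b → a ≡ b
  pos-injective refl = refl

  map-pos-++ : ∀ S R w → map pos (S ++ R) ++ w ≡ map pos S ++ map pos R ++ w
  map-pos-++ S R w = trans (cong (_++ w) (map-++ pos S R)) (++-assoc (map pos S) (map pos R) w)

  refine-head : ∀ x u {R} → π R ≤ x →
                Σ[ u′ ∈ List Carrier ] (map pos R ++ map pos u ≡ map pos u′ × π u′ ≤ π (x ∷ u))
  refine-head x u {R} R≤x =
    R ++ u , sym (map-++ pos R u) , ≤-trans (≤-reflexive (π-++ R u)) (monoˡ (π u) R≤x)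

  positive-step : ∀ u {w} → map pos u ⟶ w →
                  Σ[ u′ ∈ List Carrier ] (w ≡ map pos u′ × π u′ ≤ π u)
  positive-step (x ∷ []) (refine {R = R} R≤x) = refine-head x [] R≤x
  positive-step (x ∷ y ∷ u) (refine {R = R} R≤x) = refine-head x (y ∷ u) R≤x
  positive-step (x ∷ y ∷ u) (there s) with positive-step (y ∷ u) s
  ... | u′ , refl , u′≤yu = x ∷ u′ , refl , monoʳ x u′≤yu

  positive-steps : ∀ u {w} → map pos u ⟶* w →
                   Σ[ u′ ∈ List Carrier ] (w ≡ map pos u′ × π u′ ≤ π u)
  positive-steps u done = u , refl , ≤-refl
  positive-steps u (s ◅ ss) with positive-step u s
  ... | u′ , refl , u′≤u with positive-steps u′ ss
  ...   | u″ , w≡u″ , u″≤u′ = u″ , w≡u″ , ≤-trans u″≤u′ u′≤u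

  ⇓-sound : ∀ u t → map pos u ⇓ t → t ≤ π u
  ⇓-sound u t (u′ , u⟶*u′ , t≤u′) with positive-steps u u⟶*u′
  ... | u″ , u′≡u″ , u″≤u with map-injective pos-injective u′≡u″
  ...   | refl = ≤-trans t≤u′ u″≤u

  data Erased : Word → Word → Set ℓ where
    []   : Erased [] []
    keep : ∀ {w w′} s → Erased w w′ → Erased (s ∷ w) (s ∷ w′)
    skip : ∀ {w w′} x → Erased w w′ → Erased (pos x ∷ w) w′

  Erased-refl : ∀ w → Erased w w
  Erased-refl []      = []
  Erased-refl (s ∷ w) = keep s (Erased-refl w)

  Erased-keepAll : ∀ K {w w′} → Erased w w′ → Erased (K ++ w) (K ++ w′)
  Erased-keepAll []      e = e
  Erased-keepAll (k ∷ K) e = keep k (Erased-keepAll K e)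

  Erased-skipAll : ∀ R {w w′} → Erased w w′ → Erased (map pos R ++ w) w′
  Erased-skipAll []      e = e
  Erased-skipAll (r ∷ R) e = skip r (Erased-skipAll R e)

  Erased-step : ∀ {w w′ v} → Erased w w′ → w ⟶ v → Σ[ v′ ∈ Word ] (w′ ⟶* v′ × Erased v v′)
  Erased-step (keep _ e)          (refine {R = R} R≤x) = _ , return (refine R≤x) , Erased-keepAll (map pos R) e
  Erased-step (skip _ e)          (refine {R = R} R≤x) = _ , done , Erased-skipAll R e
  Erased-step (keep _ e)          erase                = _ , return erase , e
  Erased-step (keep _ (keep _ e)) (cancel⁺⁻ q≤p)       = _ , return (cancel⁺⁻ q≤p) , e
  Erased-step (skip _ (keep _ e)) (cancel⁺⁻ q≤p)       = _ , return erase , e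
  Erased-step (keep _ (keep _ e)) (cancel⁻⁺ q≤p)       = _ , return (cancel⁻⁺ q≤p) , e
  Erased-step (keep _ (skip _ e)) (cancel⁻⁺ q≤p)       = _ , return erase , e
  Erased-step (keep s e)          (there st) with Erased-step e st
  ... | v′ , w′⟶*v′ , e′ = s ∷ v′ , ⟶*-congˡ [ s ] w′⟶*v′ , keep s e′
  Erased-step (skip x e)          (there st) with Erased-step e st
  ... | v′ , w′⟶*v′ , e′ = v′ , w′⟶*v′ , skip x e′

  Erased-positive : ∀ {u w′} → Erased (map pos u) w′ →
                    Σ[ u′ ∈ List Carrier ] (w′ ≡ map pos u′ × π u ≤ π u′)
  Erased-positive {[]}    []         = [] , refl , ≤-refl
  Erased-positive {x ∷ u} (keep _ e) with Erased-positive e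
  ... | u′ , refl , u≤u′ = x ∷ u′ , refl , monoʳ x u≤u′
  Erased-positive {x ∷ u} (skip _ e) with Erased-positive e
  ... | u′ , refl , u≤u′ =
    u′ , refl , ≤-trans (≤-respʳ-≈ (identityˡ (π u)) (monoˡ (π u) (integral x))) u≤u′

  module Simulation
    (I : Word → Word → Set ℓ)
    (I-step : ∀ {w w′ v} → I w w′ → w ⟶ v → Σ[ v′ ∈ Word ] (w′ ⟶* v′ × I v v′))
    (I-positive : ∀ u {w′} → I (map pos u) w′ →
                  Σ[ u′ ∈ List Carrier ] (w′ ≡ map pos u′ × π u ≤ π u′))
    where

    simulate : ∀ u {w w′} → I w w′ → w ⟶* map pos u →
               Σ[ u′ ∈ List Carrier ] (w′ ⟶* map pos u′ × π u ≤ π u′)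
    simulate u i done with I-positive u i
    ... | u′ , w′≡u′ , u≤u′ = u′ , ≡⇒⟶* w′≡u′ , u≤u′
    simulate u i (s ◅ ss) with I-step i s
    ... | v′ , w′⟶*v′ , i′ with simulate u i′ ss
    ...   | u′ , v′⟶*u′ , u≤u′ = u′ , w′⟶*v′ ◅◅ v′⟶*u′ , u≤u′

    transfer : ∀ {w w′ t} → I w w′ → w ⇓ t → w′ ⇓ t
    transfer i (u , w⟶*u , t≤u) with simulate u i w⟶*u
    ... | u′ , w′⟶*u′ , u≤u′ = u′ , w′⟶*u′ , ≤-trans t≤u u≤u′

  Erased-⇓ : ∀ {w w′ t} → Erased w w′ → w ⇓ t → w′ ⇓ t
  Erased-⇓ = Simulation.transfer Erased Erased-step (λ u → Erased-positive)

  data Cancelling : Letter → Letter → Set ℓ where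
    ⁺⁻ : ∀ {p q} → q ≤ p → Cancelling (pos p) (neg q)
    ⁻⁺ : ∀ {p q} → q ≤ p → Cancelling (neg q) (pos p)

  data Step++ (A m : Word) : Word → Set ℓ where
    inˡ    : ∀ {A′} → A ⟶ A′ → Step++ A m (A′ ++ m)
    inʳ    : ∀ {m′} → m ⟶ m′ → Step++ A m (A ++ m′)
    across : ∀ {A₀ s₁ s₂ m₁} → A ≡ A₀ ++ [ s₁ ] → m ≡ s₂ ∷ m₁ → Cancelling s₁ s₂ →
             Step++ A m (A₀ ++ m₁)

  step-++ : ∀ A m {v} → A ++ m ⟶ v → Step++ A m v
  step-++ []           m s                    = inʳ s
  step-++ (a ∷ [])     m (refine {R = R} R≤x) =
    subst (Step++ _ m) (cong (_++ m) (++-identityʳ (map pos R))) (inˡ (refine R≤x))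
  step-++ (a ∷ [])     m erase                = inˡ erase
  step-++ (a ∷ [])     m (cancel⁺⁻ q≤p)       = across refl refl (⁺⁻ q≤p)
  step-++ (a ∷ [])     m (cancel⁻⁺ q≤p)       = across refl refl (⁻⁺ q≤p)
  step-++ (a ∷ [])     m (there s)            = inʳ s
  step-++ (a ∷ a′ ∷ A) m (refine {R = R} R≤x) =
    subst (Step++ _ m) (++-assoc (map pos R) (a′ ∷ A) m) (inˡ (refine R≤x))
  step-++ (a ∷ a′ ∷ A) m erase                = inˡ erase
  step-++ (a ∷ a′ ∷ A) m (cancel⁺⁻ q≤p)       = inˡ (cancel⁺⁻ q≤p)
  step-++ (a ∷ a′ ∷ A) m (cancel⁻⁺ q≤p)       = inˡ (cancel⁻⁺ q≤p)
  step-++ (a ∷ a′ ∷ A) m (there s) with step-++ (a′ ∷ A) m s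
  ... | inˡ s′           = inˡ (there s′)
  ... | inʳ s′           = inʳ s′
  ... | across eqA eqm c = across (cong (a ∷_) eqA) eqm c

  data StepPositive++ (R : List Carrier) (w : Word) : Word → Set ℓ where
    refine-inside : ∀ {Ra r Rb Rr} → R ≡ Ra ++ r ∷ Rb → π Rr ≤ r →
                    StepPositive++ R w (map pos (Ra ++ Rr ++ Rb) ++ w)
    cancel-last   : ∀ {R₀ r q w₁} → R ≡ R₀ ++ [ r ] → w ≡ neg q ∷ w₁ → q ≤ r →
                    StepPositive++ R w (map pos R₀ ++ w₁)
    beyond        : ∀ {w′} → w ⟶ w′ → StepPositive++ R w (map pos R ++ w′)

  step-positive-++ : ∀ R w {v} → map pos R ++ w ⟶ v → StepPositive++ R w v
  step-positive-++ []           w s                      = beyond s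
  step-positive-++ (r ∷ [])     w (refine {R = Rr} Rr≤r) =
    subst (StepPositive++ _ w) (cong (λ z → map pos z ++ w) (++-identityʳ Rr))
      (refine-inside {Ra = []} refl Rr≤r)
  step-positive-++ (r ∷ [])     w (cancel⁺⁻ q≤r)         = cancel-last {R₀ = []} refl refl q≤r
  step-positive-++ (r ∷ [])     w (there s)              = beyond s
  step-positive-++ (r ∷ r′ ∷ R) w (refine {R = Rr} Rr≤r) =
    subst (StepPositive++ _ w) (map-pos-++ Rr (r′ ∷ R) w) (refine-inside {Ra = []} refl Rr≤r)
  step-positive-++ (r ∷ r′ ∷ R) w (there s) with step-positive-++ (r′ ∷ R) w s
  ... | refine-inside {Ra} {Rb = Rb} {Rr} eqR Rr≤r =
          refine-inside {Ra = r ∷ Ra} {Rb = Rb} {Rr} (cong (r ∷_) eqR) Rr≤r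
  ... | cancel-last eqR eqw q≤r = cancel-last (cong (r ∷_) eqR) eqw q≤r
  ... | beyond s′               = beyond s′

  π-refine-middle : ∀ X Y {Rr r} → π Rr ≤ r → π (X ++ Rr ++ Y) ≤ π (X ++ r ∷ Y)
  π-refine-middle X Y {Rr} {r} Rr≤r =
    ≤-respˡ-≈ (≈-sym (π-++ X (Rr ++ Y)))
      (≤-respʳ-≈ (≈-sym (π-++ X (r ∷ Y)))
        (monoʳ (π X) (≤-respˡ-≈ (≈-sym (π-++ Rr Y)) (monoˡ (π Y) Rr≤r))))

  neg∉positive : ∀ X q Y u → X ++ neg q ∷ Y ≡ map pos u → ⊥
  neg∉positive []      q Y []      ()
  neg∉positive []      q Y (x ∷ u) ()
  neg∉positive (s ∷ X) q Y []      ()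
  neg∉positive (s ∷ X) q Y (x ∷ u) eq = neg∉positive X q Y u (∷-injectiveʳ eq)

  data Paired : Word → List Carrier → Set ℓ where
    []   : Paired [] []
    pair : ∀ {Q S q p} → q ≤ p → Paired Q S → Paired (neg q ∷ Q) (S ++ [ p ])

  paired-cancel⁻⁺ : ∀ {Q S} → Paired Q S → ∀ w → Q ++ map pos S ++ w ⟶* w
  paired-cancel⁻⁺ []                          w = done
  paired-cancel⁻⁺ (pair {Q} {S} {q} {p} q≤p P) w =
    ≡⇒⟶* (cong (λ z → neg q ∷ Q ++ z) (map-pos-++ S [ p ] w))
      ◅◅ ⟶*-congˡ [ neg q ] (paired-cancel⁻⁺ P (pos p ∷ w))
      ◅◅ return (cancel⁻⁺ q≤p)

  paired-cancel⁺⁻ : ∀ {Q S} → Paired Q S → ∀ w → map pos S ++ Q ++ w ⟶* w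
  paired-cancel⁺⁻ []                          w = done
  paired-cancel⁺⁻ (pair {Q} {S} {q} {p} q≤p P) w =
    ≡⇒⟶* (map-pos-++ S [ p ] (neg q ∷ Q ++ w))
      ◅◅ ⟶*-congˡ (map pos S) (return (cancel⁺⁻ q≤p))
      ◅◅ paired-cancel⁺⁻ P w

  paired-erase : ∀ {Q S} → Paired Q S → ∀ w → Q ++ w ⟶* w
  paired-erase []          w = done
  paired-erase (pair _ P) w = erase ◅ paired-erase P w

  -- Invariant for removing x x⁻¹: in w the letter x has been refined into S ++ R, and S has
  -- already cancelled against the negative letters Q, which w′ keeps in place of x x⁻¹.
  record Pending (x : Carrier) (w w′ : Word) : Set ℓ where
    constructor pending
    field
      A Q B  : Word
      S R    : List Carrier
      paired : Paired Q S
      bound  : π (S ++ R) ≤ x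
      w≡     : w ≡ A ++ map pos R ++ neg x ∷ B
      w′≡    : w′ ≡ A ++ Q ++ B

  Invariant : Carrier → Word → Word → Set ℓ
  Invariant x w w′ = Pending x w w′ ⊎ Erased w w′

  pending-across : ∀ {x} A₀ Q B S R {s₁ s₂ m₁} → Paired Q S → π (S ++ R) ≤ x →
                   map pos R ++ neg x ∷ B ≡ s₂ ∷ m₁ → Cancelling s₁ s₂ →
                   Σ[ v′ ∈ Word ] ((A₀ ++ [ s₁ ]) ++ Q ++ B ⟶* v′ × Invariant x (A₀ ++ m₁) v′)
  pending-across A₀ Q B S [] P S≤x refl (⁺⁻ {p} x≤p) =
    A₀ ++ B ,
    ≡⇒⟶* (++-assoc A₀ [ pos p ] (Q ++ B))
      ◅◅ ⟶*-congˡ A₀ (refine {R = S} S≤p ◅ paired-cancel⁺⁻ P B) ,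
    inj₂ (Erased-refl _)
    where
      S≤p : π S ≤ p
      S≤p = ≤-trans (≤-respˡ-≈ (≡⇒≈ (cong π (++-identityʳ S))) S≤x) x≤p
  pending-across A₀ Q B S (r ∷ R) P SR≤x refl (⁻⁺ {q = q} q≤r) =
    A₀ ++ neg q ∷ Q ++ B ,
    ≡⇒⟶* (++-assoc A₀ [ neg q ] (Q ++ B)) ,
    inj₁ (pending A₀ (neg q ∷ Q) B (S ++ [ r ]) R (pair q≤r P)
            (≤-respˡ-≈ (≡⇒≈ (cong π (sym (++-assoc S [ r ] R)))) SR≤x) refl refl)

  pending-beyond : ∀ {x} A Q B S R {B′} → Paired Q S → π (S ++ R) ≤ x → neg x ∷ B ⟶ B′ →
                   Σ[ v′ ∈ Word ] (A ++ Q ++ B ⟶* v′ × Invariant x (A ++ map pos R ++ B′) v′)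
  pending-beyond A Q B S R P SR≤x erase =
    A ++ B , ⟶*-congˡ A (paired-erase P B) , inj₂ (Erased-keepAll A (Erased-skipAll R (Erased-refl B)))
  pending-beyond A Q (pos p ∷ B₀) S R P SR≤x (cancel⁻⁺ x≤p) =
    A ++ map pos R ++ B₀ ,
    return (⟶-congˡ A (⟶-congˡ Q (refine {R = S ++ R} (≤-trans SR≤x x≤p))))
      ◅◅ ≡⇒⟶* (cong (λ z → A ++ Q ++ z) (map-pos-++ S R B₀))
      ◅◅ ⟶*-congˡ A (paired-cancel⁻⁺ P (map pos R ++ B₀)) ,
    inj₂ (Erased-refl _)
  pending-beyond A Q B S R P SR≤x (there {w′ = B′} s) =
    A ++ Q ++ B′ , return (⟶-congˡ A (⟶-congˡ Q s)) , inj₁ (pending A Q B′ S R P SR≤x refl refl)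

  pending-step : ∀ {x w w′ v} → Pending x w w′ → w ⟶ v →
                 Σ[ v′ ∈ Word ] (w′ ⟶* v′ × Invariant x v v′)
  pending-step {x} (pending A Q B S R P SR≤x refl refl) s with step-++ A (map pos R ++ neg x ∷ B) s
  ... | inˡ {A′} sA =
    A′ ++ Q ++ B , return (⟶-congʳ (Q ++ B) sA) , inj₁ (pending A′ Q B S R P SR≤x refl refl)
  ... | across {A₀} refl eqm c = pending-across A₀ Q B S R P SR≤x eqm c
  ... | inʳ sm with step-positive-++ R (neg x ∷ B) sm
  ...   | refine-inside {Ra} {r} {Rb} {Rr} refl Rr≤r =
    _ , done ,
    inj₁ (pending A Q B S (Ra ++ Rr ++ Rb) P
            (≤-trans (subst₂ (λ X Y → π X ≤ π Y) (++-assoc S Ra (Rr ++ Rb)) (++-assoc S Ra (r ∷ Rb))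
                               (π-refine-middle (S ++ Ra) Rb Rr≤r))
                     SR≤x)
            refl refl)
  ...   | cancel-last {R₀} refl refl _ =
    A ++ B , ⟶*-congˡ A (paired-erase P B) , inj₂ (Erased-keepAll A (Erased-skipAll R₀ (Erased-refl B)))
  ...   | beyond sB = pending-beyond A Q B S R P SR≤x sB

  invariant-step : ∀ {x w w′ v} → Invariant x w w′ → w ⟶ v →
                   Σ[ v′ ∈ Word ] (w′ ⟶* v′ × Invariant x v v′)
  invariant-step (inj₁ p) s = pending-step p s
  invariant-step (inj₂ e) s with Erased-step e s
  ... | v′ , w′⟶*v′ , e′ = v′ , w′⟶*v′ , inj₂ e′

  invariant-positive : ∀ {x} u {w′} → Invariant x (map pos u) w′ →
                       Σ[ u′ ∈ List Carrier ] (w′ ≡ map pos u′ × π u ≤ π u′)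
  invariant-positive {x} u (inj₁ (pending A Q B S R P SR≤x eq _)) =
    ⊥-elim (neg∉positive (A ++ map pos R) x B u (trans (++-assoc A (map pos R) (neg x ∷ B)) (sym eq)))
  invariant-positive u (inj₂ e) = Erased-positive e

  ⇓-cancel⁺⁻ : ∀ K L x {t} → K ++ pos x ∷ neg x ∷ L ⇓ t → K ++ L ⇓ t
  ⇓-cancel⁺⁻ K L x = Simulation.transfer (Invariant x) invariant-step invariant-positive
    (inj₁ (pending K [] L [] [ x ] [] (≤-reflexive (identityʳ x)) refl refl))

opposite : ∀ {c ℓ₁ ℓ₂} → Pomonoid c ℓ₁ ℓ₂ → Pomonoid c ℓ₁ ℓ₂
opposite N = record
  { Carrier = Carrier ; _≈_ = _≈_ ; _≤_ = _≤_ ; _∙_ = flip _∙_ ; ε = ε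
  ; isMonoid = Op.isMonoid isMonoid
  ; isPartialOrder = isPartialOrder
  ; monoˡ = monoʳ
  ; monoʳ = monoˡ
  }
  where open Pomonoid N

module Reversal {c ℓ₁ ℓ₂} (N : Pomonoid c ℓ₁ ℓ₂) where
  open Signed (c ⊔ ℓ₁ ⊔ ℓ₂) (Pomonoid.Carrier N)
  open PomonoidProperties N
  private
    module ᵒᵖ = PomonoidProperties (opposite N)
    module R = Rewriting raw
    module Rᵒᵖ = Rewriting (Pomonoid.raw (opposite N))

  π-reverse : ∀ u → ᵒᵖ.π (reverse u) ≈ π u
  π-reverse []      = ≈-refl
  π-reverse (a ∷ u) =
    ≈-trans (≡⇒≈ (cong ᵒᵖ.π (unfold-reverse a u)))
            (≈-trans (ᵒᵖ.π-++ (reverse u) [ a ]) (∙-cong (identityˡ a) (π-reverse u)))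

  reverse-step : ∀ {w v} → w R.⟶ v → reverse w Rᵒᵖ.⟶ reverse v
  reverse-step {pos x ∷ w} (R.refine {R = S} S≤x) =
    subst₂ Rᵒᵖ._⟶_ (sym (reverse-++ [ pos x ] w))
      (trans (cong (reverse w ++_) (trans (++-identityʳ _) (reverse-map pos S))) (sym (reverse-++ (map pos S) w)))
      (Rᵒᵖ.⟶-congˡ (reverse w) (Rᵒᵖ.refine {R = reverse S} (≤-respˡ-≈ (≈-sym (π-reverse S)) S≤x)))
  reverse-step {neg q ∷ w} R.erase =
    subst₂ Rᵒᵖ._⟶_ (sym (reverse-++ [ neg q ] w)) (++-identityʳ (reverse w))
      (Rᵒᵖ.⟶-congˡ (reverse w) Rᵒᵖ.erase)
  reverse-step {pos p ∷ neg q ∷ w} (R.cancel⁺⁻ q≤p) =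
    subst₂ Rᵒᵖ._⟶_ (sym (reverse-++ (pos p ∷ neg q ∷ []) w)) (++-identityʳ (reverse w))
      (Rᵒᵖ.⟶-congˡ (reverse w) (Rᵒᵖ.cancel⁻⁺ q≤p))
  reverse-step {neg q ∷ pos p ∷ w} (R.cancel⁻⁺ q≤p) =
    subst₂ Rᵒᵖ._⟶_ (sym (reverse-++ (neg q ∷ pos p ∷ []) w)) (++-identityʳ (reverse w))
      (Rᵒᵖ.⟶-congˡ (reverse w) (Rᵒᵖ.cancel⁺⁻ q≤p))
  reverse-step {s ∷ w} {s ∷ w′} (R.there st) =
    subst₂ Rᵒᵖ._⟶_ (sym (reverse-++ [ s ] w)) (sym (reverse-++ [ s ] w′))
      (Rᵒᵖ.⟶-congʳ [ s ] (reverse-step st))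

  ⇓-reverse : ∀ {w t} → w R.⇓ t → reverse w Rᵒᵖ.⇓ t
  ⇓-reverse {w} (u , w⟶*u , t≤u) =
    reverse u ,
    subst (reverse w Rᵒᵖ.⟶*_) (sym (reverse-map pos u)) (gmap reverse reverse-step w⟶*u) ,
    ≤-respʳ-≈ (≈-sym (π-reverse u)) t≤u

module IntegralRepresentation {c ℓ₁ ℓ₂} (N : Pomonoid c ℓ₁ ℓ₂) (integral : IsIntegral N) where
  open PomonoidProperties N
  open Signed (c ⊔ ℓ₁ ⊔ ℓ₂) Carrier
  open Rewriting raw
  open RewritingProperties N integral using (⇓-sound; ⇓-cancel⁺⁻; Erased-⇓; Erased-keepAll; Erased-refl; skip)
  open ContextOrder N _⇓_

  private
    ℓ : Level
    ℓ = c ⊔ ℓ₁ ⊔ ℓ₂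

  ⇓-cancel⁻⁺ : ∀ K L x {t} → K ++ neg x ∷ pos x ∷ L ⇓ t → K ++ L ⇓ t
  ⇓-cancel⁻⁺ K L x {t} =
    subst (_⇓ t) reverse-reverse
      ∘ Reversal.⇓-reverse (opposite N)
      ∘ RewritingProperties.⇓-cancel⁺⁻ (opposite N) integral (reverse L) (reverse K) x
      ∘ subst (λ w → Rewriting._⇓_ (Pomonoid.raw (opposite N)) w t) reverse-middle
      ∘ Reversal.⇓-reverse N
    where
      reverse-middle : reverse (K ++ neg x ∷ pos x ∷ L) ≡ reverse L ++ pos x ∷ neg x ∷ reverse K
      reverse-middle =
        trans (reverse-++ K (neg x ∷ pos x ∷ L))
              (trans (cong (_++ reverse K) (reverse-++ (neg x ∷ pos x ∷ []) L))
                     (++-assoc (reverse L) (pos x ∷ neg x ∷ []) (reverse K)))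
      reverse-reverse : reverse (reverse L ++ reverse K) ≡ K ++ L
      reverse-reverse =
        trans (reverse-++ (reverse L) (reverse K))
              (cong₂ _++_ (reverse-involutive K) (reverse-involutive L))

  letter-inverseʳ : ∀ s → s ∷ invert s ∷ [] ≋ []
  letter-inverseʳ (pos x) =
    (λ K L t → ⇓-cancel⁺⁻ K L x) , (λ K L t → ⇓-step (⟶-congˡ K (cancel⁺⁻ ≤-refl)))
  letter-inverseʳ (neg x) =
    (λ K L t → ⇓-cancel⁻⁺ K L x) , (λ K L t → ⇓-step (⟶-congˡ K (cancel⁻⁺ ≤-refl)))

  ⇓-complete : ∀ u → map pos u ⇓ π u
  ⇓-complete u = u , done , ≤-refl

  letter-negative : ∀ a → [ pos a ] ⊑ []
  letter-negative a K L t = Erased-⇓ (Erased-keepAll K (skip a (Erased-refl L)))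

  letter-mono : ∀ {a b} → a ≤ b → [ pos a ] ⊑ [ pos b ]
  letter-mono {a} a≤b K L t =
    ⇓-step (⟶-congˡ K (refine {R = [ a ]} (≤-respˡ-≈ (≈-sym (identityʳ a)) a≤b)))

  letter-∙ : ∀ a b → pos a ∷ pos b ∷ [] ⊑ [ pos (a ∙ b) ]
  letter-∙ a b K L t = ⇓-step (⟶-congˡ K (refine {R = a ∷ b ∷ []} (monoʳ a (≤-reflexive (identityʳ b)))))

  letter-ε : [] ⊑ [ pos ε ]
  letter-ε K L t = ⇓-step (⟶-congˡ K (refine {R = []} ≤-refl))

  representable : Representable ℓ (λ _ → Lift ℓ ⊤) N
  representable =
    group letter-inverseʳ , lift tt ,
    representation letter-inverseʳ ⇓-sound ⇓-complete letter-negative letter-mono letter-∙ letter-ε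

-- Coverings of positive letters by negative ones

mapMaybe-++ : ∀ {a b} {A : Set a} {B : Set b} (f : A → Maybe B) xs ys →
              mapMaybe f (xs ++ ys) ≡ mapMaybe f xs ++ mapMaybe f ys
mapMaybe-++ f []       ys = refl
mapMaybe-++ f (x ∷ xs) ys with f x
... | just y  = cong (y ∷_) (mapMaybe-++ f xs ys)
... | nothing = mapMaybe-++ f xs ys

module _ {a} {A : Set a} where

  interleaving-rotate : ∀ {Q X Y U V : List A} → Interleaving X Y Q → Interleaving U V Y →
                        Σ[ E ∈ List A ] (Interleaving U E Q × Interleaving X V E)
  interleaving-rotate []         []         = [] , [] , []
  interleaving-rotate (consˡ i)  j          with interleaving-rotate i j
  ... | _ , i′ , j′ = _ , consʳ i′ , consˡ j′
  interleaving-rotate (consʳ i)  (consˡ j)  with interleaving-rotate i j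
  ... | _ , i′ , j′ = _ , consˡ i′ , j′
  interleaving-rotate (consʳ i)  (consʳ j)  with interleaving-rotate i j
  ... | _ , i′ , j′ = _ , consʳ i′ , consʳ j′

  interleaving-assoc : ∀ {Q X Y U V : List A} → Interleaving X Y Q → Interleaving U V Y →
                       Σ[ M ∈ List A ] (Interleaving M V Q × Interleaving X U M)
  interleaving-assoc []         []         = [] , [] , []
  interleaving-assoc (consˡ i)  j          with interleaving-assoc i j
  ... | _ , i′ , j′ = _ , consˡ i′ , consˡ j′
  interleaving-assoc (consʳ i)  (consˡ j)  with interleaving-assoc i j
  ... | _ , i′ , j′ = _ , consˡ i′ , consʳ j′
  interleaving-assoc (consʳ i)  (consʳ j)  with interleaving-assoc i j
  ... | _ , i′ , j′ = _ , consʳ i′ , j′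

  interleaving-↭ : ∀ {Q Q′ X Y : List A} → Interleaving X Y Q → Q ↭ Q′ →
                   Σ[ X′ ∈ List A ] Σ[ Y′ ∈ List A ] (Interleaving X′ Y′ Q′ × X ↭ X′ × Y ↭ Y′)
  interleaving-↭ i ↭.refl = _ , _ , i , ↭.refl , ↭.refl
  interleaving-↭ (consˡ i) (↭.prep x p) with interleaving-↭ i p
  ... | _ , _ , i′ , pX , pY = _ , _ , consˡ i′ , ↭.prep x pX , pY
  interleaving-↭ (consʳ i) (↭.prep x p) with interleaving-↭ i p
  ... | _ , _ , i′ , pX , pY = _ , _ , consʳ i′ , pX , ↭.prep x pY
  interleaving-↭ (consˡ (consˡ i)) (↭.swap x y p) with interleaving-↭ i p
  ... | _ , _ , i′ , pX , pY = _ , _ , consˡ (consˡ i′) , ↭.swap x y pX , pY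
  interleaving-↭ (consˡ (consʳ i)) (↭.swap x y p) with interleaving-↭ i p
  ... | _ , _ , i′ , pX , pY = _ , _ , consʳ (consˡ i′) , ↭.prep x pX , ↭.prep y pY
  interleaving-↭ (consʳ (consˡ i)) (↭.swap x y p) with interleaving-↭ i p
  ... | _ , _ , i′ , pX , pY = _ , _ , consˡ (consʳ i′) , ↭.prep y pX , ↭.prep x pY
  interleaving-↭ (consʳ (consʳ i)) (↭.swap x y p) with interleaving-↭ i p
  ... | _ , _ , i′ , pX , pY = _ , _ , consʳ (consʳ i′) , pX , ↭.swap x y pY
  interleaving-↭ i (↭.trans p q) with interleaving-↭ i p
  ... | _ , _ , i′ , pX , pY with interleaving-↭ i′ q
  ...   | _ , _ , i″ , pX′ , pY′ = _ , _ , i″ , ↭.trans pX pX′ , ↭.trans pY pY′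

  interleaving-right : ∀ (Q : List A) → Interleaving [] Q Q
  interleaving-right []      = []
  interleaving-right (q ∷ Q) = consʳ (interleaving-right Q)

module CommutativeProduct {c ℓ₁ ℓ₂} (N : Pomonoid c ℓ₁ ℓ₂) (commutative : IsCommutative N) where
  open PomonoidProperties N

  commutativeSemigroup : CommutativeSemigroup c ℓ₁
  commutativeSemigroup = record
    { isCommutativeSemigroup = record { isSemigroup = IsMonoid.isSemigroup isMonoid ; comm = commutative } }

  π-↭ : ∀ {u v} → u ↭ v → π u ≈ π v
  π-↭ u↭v = PermutationProperties.foldr-commMonoid setoid
              (record { isMonoid = isMonoid ; comm = commutative })
              (↭⇒↭ₛ′ (IsMonoid.isEquivalence isMonoid) u↭v)

  π-interleaving : ∀ {u v w} → Interleaving u v w → π w ≈ π u ∙ π v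
  π-interleaving {u} {v} i = ≈-trans (π-↭ (toPermutation i)) (π-++ u v)

module Covering {c ℓ₁ ℓ₂} (N : Pomonoid c ℓ₁ ℓ₂)
  (commutative : IsCommutative N) (integral : IsIntegral N) where
  open PomonoidProperties N
  open CommutativeProduct N commutative
  open CommutativeSemigroupProperties commutativeSemigroup using (interchange; xy∙z≈xz∙y)
  open PosetReasoning poset

  ∙-absorbʳ : ∀ a d → a ∙ d ≤ a
  ∙-absorbʳ a d = ≤-respʳ-≈ (identityʳ a) (monoʳ a (integral d))

  -- Cover P Q t: every positive letter x ∈ P satisfies π Qx ∙ dx ≤ x for disjoint parts Qx of the
  -- negative letters Q, and t ≤ ∏ dx; letters of Q outside every part are discarded.
  data Cover : List Carrier → List Carrier → Carrier → Set (c ⊔ ℓ₁ ⊔ ℓ₂) where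
    []   : ∀ {Q t} → Cover [] Q t
    cons : ∀ {x P Q Qx Q′ t} b d → Interleaving Qx Q′ Q → Cover P Q′ b →
           t ≤ b ∙ d → π Qx ∙ d ≤ x → Cover (x ∷ P) Q t

  Cover-≤ : ∀ {P Q t t′} → t′ ≤ t → Cover P Q t → Cover P Q t′
  Cover-≤ t′≤t []                      = []
  Cover-≤ t′≤t (cons b d i C t≤bd Qd≤x) = cons b d i C (≤-trans t′≤t t≤bd) Qd≤x

  Cover-weaken : ∀ {P Q Q′ X t} → Interleaving X Q′ Q → Cover P Q′ t → Cover P Q t
  Cover-weaken i []                      = []
  Cover-weaken i (cons b d j C t≤bd Qd≤x) with interleaving-rotate i j
  ... | _ , i′ , j′ = cons b d i′ (Cover-weaken j′ C) t≤bd Qd≤x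

  Cover-↭ʳ : ∀ {P Q Q′ t} → Q ↭ Q′ → Cover P Q t → Cover P Q′ t
  Cover-↭ʳ p []                       = []
  Cover-↭ʳ p (cons b d i C t≤bd Qd≤x) with interleaving-↭ i p
  ... | _ , _ , i′ , pX , pY =
    cons b d i′ (Cover-↭ʳ pY C) t≤bd (≤-respˡ-≈ (∙-congʳ (π-↭ pX)) Qd≤x)

  Cover-↭ˡ : ∀ {P P′ Q t} → P ↭ P′ → Cover P Q t → Cover P′ Q t
  Cover-↭ˡ ↭.refl         C = C
  Cover-↭ˡ (↭.prep x p)   (cons b d i C t≤bd Qd≤x) = cons b d i (Cover-↭ˡ p C) t≤bd Qd≤x
  Cover-↭ˡ (↭.swap x y p) (cons b dx i (cons b′ dy j C b≤ Qd≤y) t≤ Qd≤x) with interleaving-rotate i j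
  ... | _ , i′ , j′ =
    cons (b′ ∙ dx) dy i′ (cons b′ dx j′ (Cover-↭ˡ p C) ≤-refl Qd≤x)
      (≤-trans t≤ (≤-respʳ-≈ (xy∙z≈xz∙y b′ dy dx) (monoˡ dx b≤))) Qd≤y
  Cover-↭ˡ (↭.trans p q)  C = Cover-↭ˡ q (Cover-↭ˡ p C)

  Cover-drop : ∀ {x P Q t} → Cover (x ∷ P) Q t → Cover P Q t
  Cover-drop (cons b d i C t≤bd _) = Cover-≤ (≤-trans t≤bd (∙-absorbʳ b d)) (Cover-weaken i C)

  Cover-trade : ∀ {x P Q₀ Q Qx b d} → Cover P (x ∷ Q₀) b → Interleaving Qx Q₀ Q → π Qx ∙ d ≤ x →
                Cover P Q (b ∙ d)
  Cover-trade [] _ _ = []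
  Cover-trade {x} {Qx = Qx} {b} {d} (cons {x = y} {Qx = x ∷ Qy} b′ dy (consˡ j) C b≤ Qdy≤y) i Qd≤x
    with interleaving-assoc i j
  ... | M , i′ , j′ = cons b′ (d ∙ dy) i′ C b∙d≤ QMd≤y
    where
      b∙d≤ : b ∙ d ≤ b′ ∙ (d ∙ dy)
      b∙d≤ = begin
        b ∙ d          ≤⟨ monoˡ d b≤ ⟩
        (b′ ∙ dy) ∙ d  ≈⟨ xy∙z≈xz∙y b′ dy d ⟩
        (b′ ∙ d) ∙ dy  ≈⟨ assoc b′ d dy ⟩
        b′ ∙ (d ∙ dy)  ∎
      QMd≤y : π M ∙ (d ∙ dy) ≤ y
      QMd≤y = begin
        π M ∙ (d ∙ dy)               ≈⟨ ∙-congʳ (π-interleaving j′) ⟩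
        (π Qx ∙ π Qy) ∙ (d ∙ dy)     ≈⟨ interchange (π Qx) (π Qy) d dy ⟩
        (π Qx ∙ d) ∙ (π Qy ∙ dy)     ≤⟨ monoˡ (π Qy ∙ dy) Qd≤x ⟩
        x ∙ (π Qy ∙ dy)              ≈⟨ assoc x (π Qy) dy ⟨
        π (x ∷ Qy) ∙ dy              ≤⟨ Qdy≤y ⟩
        y                            ∎
  Cover-trade {d = d} (cons b′ dy (consʳ j) C b≤ Qdy≤y) i Qd≤x with interleaving-rotate i j
  ... | _ , i′ , j′ =
    cons (b′ ∙ d) dy i′ (Cover-trade C j′ Qd≤x)
      (≤-trans (monoˡ d b≤) (≤-reflexive (xy∙z≈xz∙y b′ dy d))) Qdy≤y

  -- Either the negative x lies in the part of the positive x, and both are dropped, or another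
  -- part uses it, and Cover-trade puts the part of the positive x in its place.
  Cover-cancel : ∀ {x P Q t} → Cover (x ∷ P) (x ∷ Q) t → Cover P Q t
  Cover-cancel (cons b d (consˡ i) C t≤bd _)    = Cover-≤ (≤-trans t≤bd (∙-absorbʳ b d)) (Cover-weaken i C)
  Cover-cancel (cons b d (consʳ i) C t≤bd Qd≤x) = Cover-≤ t≤bd (Cover-trade C i Qd≤x)

  Cover-uncancel : ∀ {x P Q t} → Cover P Q t → Cover (x ∷ P) (x ∷ Q) t
  Cover-uncancel {x} {Q = Q} {t} C =
    cons t ε (consˡ (interleaving-right Q)) C
      (≤-reflexive (≈-sym (identityʳ t))) (≤-reflexive (≈-trans (identityʳ _) (identityʳ x)))

  Cover-sound : ∀ u {t} → Cover u [] t → t ≤ π u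
  Cover-sound []      {t} []                           = integral t
  Cover-sound (x ∷ u) {t} (cons b d [] C t≤bd εd≤x) = begin
    t        ≤⟨ t≤bd ⟩
    b ∙ d    ≤⟨ ∙-mono (Cover-sound u C) (≤-respˡ-≈ (identityˡ d) εd≤x) ⟩
    π u ∙ x  ≈⟨ commutative (π u) x ⟩
    π (x ∷ u) ∎

  Cover-complete : ∀ u → Cover u [] (π u)
  Cover-complete []      = []
  Cover-complete (x ∷ u) =
    cons (π u) x [] (Cover-complete u) (≤-reflexive (commutative x (π u))) (≤-reflexive (identityˡ x))

  Cover-head-mono : ∀ {a b P Q t} → a ≤ b → Cover (a ∷ P) Q t → Cover (b ∷ P) Q t
  Cover-head-mono a≤b (cons b d i C t≤bd Qd≤a) = cons b d i C t≤bd (≤-trans Qd≤a a≤b)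

  Cover-head-∙ : ∀ {a b P Q t} → Cover (a ∷ b ∷ P) Q t → Cover (a ∙ b ∷ P) Q t
  Cover-head-∙ {a} {b} {t = t} (cons b₁ da i (cons b₂ db j C b₁≤ Qdb≤b) t≤ Qda≤a)
    with interleaving-assoc i j
  ... | M , i′ , j′ = cons b₂ (da ∙ db) i′ C t≤′ QMd≤
    where
      t≤′ : t ≤ b₂ ∙ (da ∙ db)
      t≤′ = begin
        t                ≤⟨ t≤ ⟩
        b₁ ∙ da          ≤⟨ monoˡ da b₁≤ ⟩
        (b₂ ∙ db) ∙ da   ≈⟨ xy∙z≈xz∙y b₂ db da ⟩
        (b₂ ∙ da) ∙ db   ≈⟨ assoc b₂ da db ⟩
        b₂ ∙ (da ∙ db)   ∎
      QMd≤ : π M ∙ (da ∙ db) ≤ a ∙ b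
      QMd≤ = ≤-respˡ-≈ (≈-sym (≈-trans (∙-congʳ (π-interleaving j′)) (interchange _ _ da db)))
               (∙-mono Qda≤a Qdb≤b)

  Cover-head-ε : ∀ {P Q t} → Cover P Q t → Cover (ε ∷ P) Q t
  Cover-head-ε {Q = Q} {t} C =
    cons t ε (interleaving-right Q) C (≤-reflexive (≈-sym (identityʳ t))) (≤-reflexive (identityʳ ε))

module AbelianRepresentation {c ℓ₁ ℓ₂} (N : Pomonoid c ℓ₁ ℓ₂)
  (commutative : IsCommutative N) (integral : IsIntegral N) where
  open PomonoidProperties N
  open Signed (c ⊔ ℓ₁ ⊔ ℓ₂) Carrier
  open Covering N commutative integral

  private
    ℓ : Level
    ℓ = c ⊔ ℓ₁ ⊔ ℓ₂

  positive? negative? : Letter → Maybe Carrier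
  positive? (pos x) = just x
  positive? (neg _) = nothing
  negative? (pos _) = nothing
  negative? (neg x) = just x

  positives negatives : Word → List Carrier
  positives = mapMaybe positive?
  negatives = mapMaybe negative?

  positives-map-pos : ∀ u → positives (map pos u) ≡ u
  positives-map-pos []      = refl
  positives-map-pos (x ∷ u) = cong (x ∷_) (positives-map-pos u)

  negatives-map-pos : ∀ u → negatives (map pos u) ≡ []
  negatives-map-pos []      = refl
  negatives-map-pos (x ∷ u) = negatives-map-pos u

  infix 4 _⇓_
  _⇓_ : Word → Carrier → Set ℓ
  w ⇓ t = Cover (positives w) (negatives w) t

  open ContextOrder N _⇓_

  ⇓-↭ : ∀ {w w′ t} → w ↭ w′ → w ⇓ t → w′ ⇓ t
  ⇓-↭ p = Cover-↭ˡ (mapMaybe-↭ positive? p) ∘ Cover-↭ʳ (mapMaybe-↭ negative? p)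

  Cover-≡ : ∀ {P P′ Q Q′ t} → P ≡ P′ → Q ≡ Q′ → Cover P Q t → Cover P′ Q′ t
  Cover-≡ {t = t} = subst₂ (λ P Q → Cover P Q t)

  ⊑-from-Cover : ∀ {v w} →
    (∀ {P Q t} → Cover (positives v ++ P) (negatives v ++ Q) t →
                 Cover (positives w ++ P) (negatives w ++ Q) t) →
    v ⊑ w
  ⊑-from-Cover {v} {w} covers K L t =
    ⇓-↭ (shifts w K)
      ∘ Cover-≡ (sym (mapMaybe-++ positive? w (K ++ L))) (sym (mapMaybe-++ negative? w (K ++ L)))
      ∘ covers
      ∘ Cover-≡ (mapMaybe-++ positive? v (K ++ L)) (mapMaybe-++ negative? v (K ++ L))
      ∘ ⇓-↭ (shifts K v)

  letter-inverseʳ : ∀ s → s ∷ invert s ∷ [] ≋ []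
  letter-inverseʳ (pos x) = ⊑-from-Cover Cover-cancel , ⊑-from-Cover Cover-uncancel
  letter-inverseʳ (neg x) = ⊑-from-Cover Cover-cancel , ⊑-from-Cover Cover-uncancel

  abelian : IsAbelian (group letter-inverseʳ)
  abelian v w = (λ K L t → ⇓-↭ (++⁺ˡ K (++⁺ʳ L (++-comm v w))))
              , (λ K L t → ⇓-↭ (++⁺ˡ K (++⁺ʳ L (++-comm w v))))

  ⇓-sound : ∀ u t → map pos u ⇓ t → t ≤ π u
  ⇓-sound u t = Cover-sound u ∘ Cover-≡ (positives-map-pos u) (negatives-map-pos u)

  ⇓-complete : ∀ u → map pos u ⇓ π u
  ⇓-complete u = Cover-≡ (sym (positives-map-pos u)) (sym (negatives-map-pos u)) (Cover-complete u)

  letter-negative : ∀ a → [ pos a ] ⊑ []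
  letter-negative a = ⊑-from-Cover Cover-drop

  letter-mono : ∀ {a b} → a ≤ b → [ pos a ] ⊑ [ pos b ]
  letter-mono a≤b = ⊑-from-Cover (Cover-head-mono a≤b)

  letter-∙ : ∀ a b → pos a ∷ pos b ∷ [] ⊑ [ pos (a ∙ b) ]
  letter-∙ a b = ⊑-from-Cover Cover-head-∙

  letter-ε : [] ⊑ [ pos ε ]
  letter-ε = ⊑-from-Cover Cover-head-ε

  representable : Representable ℓ IsAbelian N
  representable =
    group letter-inverseʳ , abelian ,
    representation letter-inverseʳ ⇓-sound ⇓-complete letter-negative letter-mono letter-∙ letter-ε

theoremB : ∀ {c ℓ₁ ℓ₂} (N : Pomonoid c ℓ₁ ℓ₂)
    → (IsIntegral N ⇔ Representable (c ⊔ ℓ₁ ⊔ ℓ₂) (λ _ → Lift (c ⊔ ℓ₁ ⊔ ℓ₂) ⊤) N)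
      × ((IsCommutative N × IsIntegral N) ⇔ Representable (c ⊔ ℓ₁ ⊔ ℓ₂) IsAbelian N)
theoremB N =
  mk⇔ (IntegralRepresentation.representable N) (representable⇒integral N) ,
  mk⇔ (λ (commutative , integral) → AbelianRepresentation.representable N commutative integral)
      (λ rep → abelian-representable⇒commutative N rep , representable⇒integral N rep)
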